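{- Let $n\ge 2$, let $P_n$ be the path on $n$ vertices, and let $\tfrac12 \le \beta < 1$. Then $\beta\text{ -pack}(P_n) = n-2$, and for every $\beta$-packing set $S$ of $P_n$ the subgraph induced by $V-S$ is connected.
   Context: Let $G=(V,E)$ be a graph, $N(v)=\{u : uv\in E\}$ the open neighborhood of $v$, and fix $\beta$ with $0<\beta\le 1$. A set $S\subsetneq V$ (a proper subset) is a $\beta$-packing set of $G$ if (i) for every $v\in V-S$, $|N(v)\cap S|\le \beta\,|N(v)|$, and (ii) $S$ is maximal with respect to inclusion among proper subsets of $V$ having property (i). The $\beta$-packing number $\beta\text{ -pack}(G)$ is the maximum cardinality of a $\beta$-packing set of $G$.
   Formalization: The parameter β, subject to ½ ≤ β < 1, ranges over the rationals. -}

module Defs where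

open import Data.Nat as ℕ using (ℕ; zero; suc; _∸_)
open import Data.Bool using (Bool; true; false; _∨_)
open import Data.Fin using (Fin; toℕ)
open import Data.Fin.Subset using (Subset; ∣_∣; _∩_; _∈_; _∉_; _⊆_)
open import Data.Vec using (tabulate)
open import Data.Integer using (+_)
open import Data.Rational using (ℚ; _/_; _*_; _≤_)
open import Data.Product using (Σ; ∃; _×_)
open import Relation.Binary.PropositionalEquality using (_≡_)
open import Relation.Nullary using (¬_)

record Graph (n : ℕ) : Set where
  field
    adj   : Fin n → Fin n → Bool
    sym   : ∀ u v → adj u v ≡ adj v u
    irrefl : ∀ v → adj v v ≡ false
open Graph public

N : ∀ {n} → Graph n → Fin n → Subset n
N G v = tabulate (adj G v)

eqℕ : ℕ → ℕ → Bool
eqℕ zero zero = true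
eqℕ zero (suc _) = false
eqℕ (suc _) zero = false
eqℕ (suc a) (suc b) = eqℕ a b

eqℕ-sym : ∀ a b → eqℕ a b ≡ eqℕ b a
eqℕ-sym zero zero = Relation.Binary.PropositionalEquality.refl
eqℕ-sym zero (suc b) = Relation.Binary.PropositionalEquality.refl
eqℕ-sym (suc a) zero = Relation.Binary.PropositionalEquality.refl
eqℕ-sym (suc a) (suc b) = eqℕ-sym a b

eqℕ-suc : ∀ a → eqℕ a (suc a) ≡ false
eqℕ-suc zero = Relation.Binary.PropositionalEquality.refl
eqℕ-suc (suc a) = eqℕ-suc a

pathAdj : ℕ → ℕ → Bool
pathAdj i j = eqℕ (suc i) j ∨ eqℕ (suc j) i

private
  open Relation.Binary.PropositionalEquality using (refl; cong₂; trans)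
  ∨-comm : ∀ a b → (a ∨ b) ≡ (b ∨ a)
  ∨-comm false false = refl
  ∨-comm false true = refl
  ∨-comm true false = refl
  ∨-comm true true = refl

  pathAdj-irr : ∀ i → pathAdj i i ≡ false
  pathAdj-irr i rewrite eqℕ-sym (suc i) i | eqℕ-suc i = refl

P : (n : ℕ) → Graph n
P n = record
  { adj = λ u v → pathAdj (toℕ u) (toℕ v)
  ; sym = λ u v → ∨-comm (eqℕ (suc (toℕ u)) (toℕ v)) (eqℕ (suc (toℕ v)) (toℕ u))
  ; irrefl = λ v → pathAdj-irr (toℕ v)
  }

ℕ→ℚ : ℕ → ℚ
ℕ→ℚ k = + k / 1

Proper : ∀ {n} → Subset n → Set
Proper {n} S = ∃ λ (v : Fin n) → v ∉ S

PropI : ∀ {n} → Graph n → ℚ → Subset n → Set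
PropI {n} G β S = ∀ (v : Fin n) → v ∉ S → ℕ→ℚ ∣ N G v ∩ S ∣ ≤ β * ℕ→ℚ ∣ N G v ∣

IsBetaPacking : ∀ {n} → Graph n → ℚ → Subset n → Set
IsBetaPacking {n} G β S =
  Proper S × PropI G β S ×
  (∀ (T : Subset n) → Proper T → PropI G β T → S ⊆ T → T ⊆ S)

BetaPackNumberIs : ∀ {n} → Graph n → ℚ → ℕ → Set
BetaPackNumberIs {n} G β k =
  (∃ λ (S : Subset n) → IsBetaPacking G β S × ∣ S ∣ ≡ k) ×
  (∀ (S : Subset n) → IsBetaPacking G β S → ∣ S ∣ ℕ.≤ k)

data ReachIn {n} (G : Graph n) (W : Subset n) : Fin n → Fin n → Set where
  here : ∀ {u} → u ∈ W → ReachIn G W u u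
  step : ∀ {u w v} → u ∈ W → adj G u w ≡ true → ReachIn G W w v → ReachIn G W u v

InducedConnected : ∀ {n} → Graph n → Subset n → Set
InducedConnected {n} G W = ∀ (u v : Fin n) → u ∈ W → v ∈ W → ReachIn G W u v

-- When β < 1, a vertex outside a set S with property (i) that has any neighbour must also
-- have a neighbour outside S; so every proper set with property (i) avoids both ends of
-- some edge, i.e. lies inside the complement of an edge. When β ≥ ½ and all degrees are
-- at most 2, complements of edges have property (i) themselves, since each endpoint has
-- at most one of its at most two neighbours inside. Hence in P_n (n ≥ 2) the β-packing
-- sets are exactly the complements of edges: they have n − 2 vertices and leave behind a
-- single edge, which is connected.

module Submission where

open import Defs
open import Data.Nat using (ℕ; _≤_; _∸_)
open import Data.Fin.Subset using (Subset; ∁)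
open import Data.Rational using (ℚ; ½; 1ℚ) renaming (_≤_ to _≤ℚ_; _<_ to _<ℚ_)
open import Data.Product using (_×_)

open import Data.Nat using (zero; suc; z≤n; s≤s; _<_)
import Data.Nat.Properties as ℕP
import Data.Nat.Coprimality as Coprime
open import Data.Bool using (true; false; not)
open import Data.Bool.Properties using (not-involutive)
open import Data.Fin as Fin using (Fin; toℕ; inject₁)
open import Data.Fin.Properties using (toℕ-injective; toℕ-inject₁; suc-injective; 0≢1+n)
open import Data.Fin.Subset using (_∈_; _∉_; _⊆_; _⊇_; _∩_; _∪_; _-_; ⁅_⁆; ∣_∣; inside; outside)
open import Data.Fin.Subset.Properties
open import Data.Vec using ([]; _∷_; here; there)
open import Data.Vec.Properties using (lookup∘tabulate; []=⇒lookup; lookup⇒[]=; map-∘; map-cong; map-id)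
open import Data.Product using (∃; ∃₂; _,_)
open import Data.Sum using (_⊎_; inj₁; inj₂)
open import Data.Integer as ℤ using (+_)
import Data.Integer.Properties as ℤP
open import Data.Rational using (_*_; mkℚ; *≤*; NonNegative; Positive; nonNegative)
import Data.Rational.Properties as ℚP
open import Function using (_∘_)
open import Relation.Nullary using (¬_; yes; no; contradiction)
open import Relation.Binary.PropositionalEquality
  using (_≡_; _≢_; refl; trans; cong; subst; subst₂)
import Relation.Binary.PropositionalEquality as ≡

-- `+ k / 1` is normalised through a gcd, so it is only propositionally a literal fraction.
ℕ→ℚ≡mkℚ : ∀ k → ℕ→ℚ k ≡ mkℚ (+ k) 0 (Coprime.sym (Coprime.1-coprimeTo k))
ℕ→ℚ≡mkℚ k = ℚP.normalize-coprime (Coprime.sym (Coprime.1-coprimeTo k))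

ℕ→ℚ-mono-≤ : ∀ {m n} → m ≤ n → ℕ→ℚ m ≤ℚ ℕ→ℚ n
ℕ→ℚ-mono-≤ {m} {n} m≤n rewrite ℕ→ℚ≡mkℚ m | ℕ→ℚ≡mkℚ n =
  *≤* (subst₂ ℤ._≤_ (≡.sym (ℤP.*-identityʳ (+ m))) (≡.sym (ℤP.*-identityʳ (+ n))) (ℤ.+≤+ m≤n))

p<1⇒ℕ→ℚ[d]≰p*ℕ→ℚ[d] : ∀ {p} → p <ℚ 1ℚ → ∀ {d} → 0 < d → ¬ (ℕ→ℚ d ≤ℚ p * ℕ→ℚ d)
p<1⇒ℕ→ℚ[d]≰p*ℕ→ℚ[d] {p} p<1 {suc d} _ d≤pd =
  ℚP.<-irrefl refl (ℚP.≤-<-trans d≤pd (subst (p * q <ℚ_) (ℚP.*-identityˡ q) (ℚP.*-monoˡ-<-pos q p<1)))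
  where
  q : ℚ
  q = ℕ→ℚ (suc d)
  instance
    q-pos : Positive q
    q-pos = ℚP.normalize-pos (suc d) 1

½≤p⇒nonNeg : ∀ {p} → ½ ≤ℚ p → NonNegative p
½≤p⇒nonNeg ½≤p = nonNegative (ℚP.≤-trans (ℚP.nonNegative⁻¹ ½) ½≤p)

½≤p⇒ℕ→ℚ[k]≤p*ℕ→ℚ[d] : ∀ {p} → ½ ≤ℚ p → ∀ {k d} → k ≤ 1 → k < d → ℕ→ℚ k ≤ℚ p * ℕ→ℚ d
½≤p⇒ℕ→ℚ[k]≤p*ℕ→ℚ[d] {p} ½≤p {zero} {d} _ _ =
  ℚP.nonNegative⁻¹ (p * ℕ→ℚ d) {{ℚP.nonNeg*nonNeg⇒nonNeg p (ℕ→ℚ d)}}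
  where
  instance
    p-nonNeg : NonNegative p
    p-nonNeg = ½≤p⇒nonNeg ½≤p
    d-nonNeg : NonNegative (ℕ→ℚ d)
    d-nonNeg = ℚP.normalize-nonNeg d 1
½≤p⇒ℕ→ℚ[k]≤p*ℕ→ℚ[d] {p} ½≤p {suc zero} {suc (suc d)} (s≤s z≤n) (s≤s (s≤s _)) =
  ℚP.≤-trans (ℚP.*-monoʳ-≤-nonNeg (ℕ→ℚ 2) ½≤p)
             (ℚP.*-monoˡ-≤-nonNeg p {{½≤p⇒nonNeg ½≤p}} (ℕ→ℚ-mono-≤ {2} {suc (suc d)} (s≤s (s≤s z≤n))))

pair : ∀ {n} → Fin n → Fin n → Subset n
pair x y = ⁅ x ⁆ ∪ ⁅ y ⁆

x∈pair : ∀ {n} (x y : Fin n) → x ∈ pair x y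
x∈pair x y = x∈p∪q⁺ (inj₁ (x∈⁅x⁆ x))

y∈pair : ∀ {n} (x y : Fin n) → y ∈ pair x y
y∈pair x y = x∈p∪q⁺ (inj₂ (x∈⁅x⁆ y))

∈pair⁻ : ∀ {n} {z x y : Fin n} → z ∈ pair x y → z ≡ x ⊎ z ≡ y
∈pair⁻ {x = x} {y} z∈ with x∈p∪q⁻ ⁅ x ⁆ ⁅ y ⁆ z∈
... | inj₁ z∈⁅x⁆ = inj₁ (x∈⁅y⁆⇒x≡y x z∈⁅x⁆)
... | inj₂ z∈⁅y⁆ = inj₂ (x∈⁅y⁆⇒x≡y y z∈⁅y⁆)

∉pair⁺ : ∀ {n} {z x y : Fin n} → z ≢ x → z ≢ y → z ∉ pair x y
∉pair⁺ z≢x z≢y z∈ with ∈pair⁻ z∈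
... | inj₁ z≡x = z≢x z≡x
... | inj₂ z≡y = z≢y z≡y

∣pair∣≡2 : ∀ {n} {x y : Fin n} → x ≢ y → ∣ pair x y ∣ ≡ 2
∣pair∣≡2 {x = Fin.zero}  {Fin.zero}  x≢y = contradiction refl x≢y
∣pair∣≡2 {x = Fin.zero}  {Fin.suc y} _   = cong suc (trans (cong ∣_∣ (∪-identityˡ ⁅ y ⁆)) (∣⁅x⁆∣≡1 y))
∣pair∣≡2 {x = Fin.suc x} {Fin.zero}  _   = cong suc (trans (cong ∣_∣ (∪-identityʳ ⁅ x ⁆)) (∣⁅x⁆∣≡1 x))
∣pair∣≡2 {x = Fin.suc x} {Fin.suc y} x≢y = ∣pair∣≡2 (x≢y ∘ cong Fin.suc)

pair-⊆⇒⊇ : ∀ {n} {x y a b : Fin n} → x ≢ y → pair x y ⊆ pair a b → pair x y ⊇ pair a b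
pair-⊆⇒⊇ {x = x} {y} x≢y ⊆ z∈ = cover (∈pair⁻ z∈) (∈pair⁻ (⊆ (x∈pair x y))) (∈pair⁻ (⊆ (y∈pair x y)))
  where
  cover : ∀ {z a b} → z ≡ a ⊎ z ≡ b → x ≡ a ⊎ x ≡ b → y ≡ a ⊎ y ≡ b → z ∈ pair x y
  cover (inj₁ refl) (inj₁ refl) _           = x∈pair x y
  cover (inj₂ refl) (inj₂ refl) _           = x∈pair x y
  cover (inj₁ refl) (inj₂ refl) (inj₁ refl) = y∈pair x y
  cover (inj₂ refl) (inj₁ refl) (inj₂ refl) = y∈pair x y
  cover (inj₁ refl) (inj₂ refl) (inj₂ refl) = contradiction refl x≢y
  cover (inj₂ refl) (inj₁ refl) (inj₁ refl) = contradiction refl x≢y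

∁-involutive : ∀ {n} (p : Subset n) → ∁ (∁ p) ≡ p
∁-involutive p = trans (≡.sym (map-∘ not not p)) (trans (map-cong not-involutive p) (map-id p))

∣p∣≤1 : ∀ {n} (p : Subset n) → (∀ {x y} → x ∈ p → y ∈ p → x ≡ y) → ∣ p ∣ ≤ 1
∣p∣≤1 []            _      = z≤n
∣p∣≤1 (outside ∷ p) unique = ∣p∣≤1 p (λ x∈ y∈ → suc-injective (unique (there x∈) (there y∈)))
∣p∣≤1 {suc n} (inside ∷ p) unique = s≤s (ℕP.≤-reflexive ∣p∣≡0)
  where
  ∣p∣≡0 : ∣ p ∣ ≡ 0
  ∣p∣≡0 = trans (cong ∣_∣ (Empty-unique (λ (x , x∈) → 0≢1+n (unique here (there x∈))))) (∣⊥∣≡0 n)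

x∈p-y⇒x≢y : ∀ {n} {p : Subset n} {x y} → x ∈ p - y → x ≢ y
x∈p-y⇒x≢y {p = _ ∷ p} {Fin.suc x} (there x∈) refl = x∈p-y⇒x≢y {p = p} x∈ refl

NoIsolatedVertices : ∀ {n} → Graph n → Set
NoIsolatedVertices G = ∀ v → ∃ λ w → w ∈ N G v

MaxDegree≤2 : ∀ {n} → Graph n → Set
MaxDegree≤2 G = ∀ v u → u ∈ N G v → ∣ N G v - u ∣ ≤ 1

IsEdgeComplement : ∀ {n} → Graph n → Subset n → Set
IsEdgeComplement G S = ∃₂ λ a b → b ∈ N G a × S ≡ ∁ (pair a b)

module _ {n : ℕ} (G : Graph n) where

  ∈N⇒adj : ∀ {v w} → w ∈ N G v → adj G v w ≡ true
  ∈N⇒adj {w = w} w∈N = trans (≡.sym (lookup∘tabulate _ w)) ([]=⇒lookup w∈N)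

  adj⇒∈N : ∀ {v w} → adj G v w ≡ true → w ∈ N G v
  adj⇒∈N {w = w} vw = lookup⇒[]= w _ (trans (lookup∘tabulate _ w) vw)

  ∈N-sym : ∀ {v w} → w ∈ N G v → v ∈ N G w
  ∈N-sym {v} {w} w∈N = adj⇒∈N (trans (Graph.sym G w v) (∈N⇒adj w∈N))

  ∈N⇒≢ : ∀ {v w} → w ∈ N G v → v ≢ w
  ∈N⇒≢ {v} v∈N refl with trans (≡.sym (∈N⇒adj v∈N)) (irrefl G v)
  ... | ()

  pair-connected : ∀ {a b} → b ∈ N G a → InducedConnected G (pair a b)
  pair-connected b∈N u v u∈ v∈ with ∈pair⁻ u∈ | ∈pair⁻ v∈
  ... | inj₁ refl | inj₁ refl = here u∈
  ... | inj₁ refl | inj₂ refl = step u∈ (∈N⇒adj b∈N) (here v∈)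
  ... | inj₂ refl | inj₁ refl = step u∈ (∈N⇒adj (∈N-sym b∈N)) (here v∈)
  ... | inj₂ refl | inj₂ refl = here u∈

  isEdgeComplement⇒∣S∣≡n∸2 : ∀ {S} → IsEdgeComplement G S → ∣ S ∣ ≡ n ∸ 2
  isEdgeComplement⇒∣S∣≡n∸2 (a , b , b∈N , refl) =
    trans (∣∁p∣≡n∸∣p∣ (pair a b)) (cong (n ∸_) (∣pair∣≡2 (∈N⇒≢ b∈N)))

  isEdgeComplement⇒∁-connected : ∀ {S} → IsEdgeComplement G S → InducedConnected G (∁ S)
  isEdgeComplement⇒∁-connected (a , b , b∈N , refl) =
    subst (InducedConnected G) (≡.sym (∁-involutive (pair a b))) (pair-connected b∈N)

  module _ {β : ℚ} where

    PropI⇒neighbour∉ : β <ℚ 1ℚ → ∀ {S} → PropI G β S →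
                       ∀ {v u} → v ∉ S → u ∈ N G v → ∃ λ w → w ∈ N G v × w ∉ S
    PropI⇒neighbour∉ β<1 {S} propI {v} {u} v∉S u∈N with nonempty? (N G v ∩ ∁ S)
    ... | yes (w , w∈) = let (w∈N , w∈∁S) = x∈p∩q⁻ (N G v) (∁ S) w∈ in w , w∈N , x∈∁p⇒x∉p w∈∁S
    ... | no ∄w = contradiction (subst (λ k → ℕ→ℚ k ≤ℚ β * ℕ→ℚ ∣ N G v ∣) ∣N∩S∣≡∣N∣ (propI v v∉S))
                                (p<1⇒ℕ→ℚ[d]≰p*ℕ→ℚ[d] β<1 (ℕP.m<n⇒0<n (x∈p⇒∣p-x∣<∣p∣ u∈N)))
      where
      N⊆S : N G v ⊆ S
      N⊆S w∈N = x∉∁p⇒x∈p (λ w∈∁S → ∄w (_ , x∈p∩q⁺ (w∈N , w∈∁S)))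
      ∣N∩S∣≡∣N∣ : ∣ N G v ∩ S ∣ ≡ ∣ N G v ∣
      ∣N∩S∣≡∣N∣ = ℕP.≤-antisym (∣p∩q∣≤∣p∣ (N G v) S) (p⊆q⇒∣p∣≤∣q∣ (λ w∈N → x∈p∩q⁺ (w∈N , N⊆S w∈N)))

    proper-PropI⇒⊆∁edge : β <ℚ 1ℚ → NoIsolatedVertices G → ∀ {S} → Proper S → PropI G β S →
                          ∃₂ λ c d → d ∈ N G c × S ⊆ ∁ (pair c d)
    proper-PropI⇒⊆∁edge β<1 noIsolated (c , c∉S) propI with noIsolated c
    ... | u , u∈N with PropI⇒neighbour∉ β<1 propI c∉S u∈N
    ... | d , d∈N , d∉S = c , d , d∈N , λ x∈S → x∉p⇒x∈∁p (∉pair⁺ (∈∧∉⇒≢ x∈S c∉S) (∈∧∉⇒≢ x∈S d∉S))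
      where
      ∈∧∉⇒≢ : ∀ {S x y} → x ∈ S → y ∉ S → x ≢ y
      ∈∧∉⇒≢ x∈S y∉S refl = y∉S x∈S

    neighbour∉⇒fraction≤β : ½ ≤ℚ β → MaxDegree≤2 G → ∀ {T v u} → u ∈ N G v → u ∉ T →
                       ℕ→ℚ ∣ N G v ∩ T ∣ ≤ℚ β * ℕ→ℚ ∣ N G v ∣
    neighbour∉⇒fraction≤β ½≤β maxDegree≤2 {T} {v} {u} u∈N u∉T =
      ½≤p⇒ℕ→ℚ[k]≤p*ℕ→ℚ[d] ½≤β (ℕP.≤-trans ∣N∩T∣≤∣N-u∣ (maxDegree≤2 v u u∈N))
                               (ℕP.≤-<-trans ∣N∩T∣≤∣N-u∣ (x∈p⇒∣p-x∣<∣p∣ u∈N))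
      where
      N∩T⊆N-u : N G v ∩ T ⊆ N G v - u
      N∩T⊆N-u x∈ = let (x∈N , x∈T) = x∈p∩q⁻ (N G v) T x∈ in x∈p∧x≢y⇒x∈p-y x∈N (λ { refl → u∉T x∈T })
      ∣N∩T∣≤∣N-u∣ : ∣ N G v ∩ T ∣ ≤ ∣ N G v - u ∣
      ∣N∩T∣≤∣N-u∣ = p⊆q⇒∣p∣≤∣q∣ N∩T⊆N-u

    maxDegree≤2⇒∁edge-PropI : ½ ≤ℚ β → MaxDegree≤2 G → ∀ {a b} → b ∈ N G a → PropI G β (∁ (pair a b))
    maxDegree≤2⇒∁edge-PropI ½≤β maxDegree≤2 {a} {b} b∈N v v∉T with ∈pair⁻ (x∉∁p⇒x∈p v∉T)
    ... | inj₁ refl = neighbour∉⇒fraction≤β ½≤β maxDegree≤2 b∈N (x∈p⇒x∉∁p (y∈pair a b))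
    ... | inj₂ refl = neighbour∉⇒fraction≤β ½≤β maxDegree≤2 (∈N-sym b∈N) (x∈p⇒x∉∁p (x∈pair a b))

    module EdgeComplements (β<1 : β <ℚ 1ℚ) (noIsolated : NoIsolatedVertices G)
             (∁edge-PropI : ∀ {a b} → b ∈ N G a → PropI G β (∁ (pair a b))) where

      isEdgeComplement⇒isBetaPacking : ∀ {S} → IsEdgeComplement G S → IsBetaPacking G β S
      isEdgeComplement⇒isBetaPacking (a , b , b∈N , refl) =
        (a , x∈p⇒x∉∁p (x∈pair a b)) , ∁edge-PropI b∈N , maximal
        where
        maximal : ∀ U → Proper U → PropI G β U → ∁ (pair a b) ⊆ U → U ⊆ ∁ (pair a b)
        maximal U U-proper U-propI T⊆U with proper-PropI⇒⊆∁edge β<1 noIsolated U-proper U-propI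
        ... | c , d , d∈N , U⊆ =
          ⊆-trans U⊆ (p⊆q⇒∁p⊇∁q (pair-⊆⇒⊇ (∈N⇒≢ d∈N) (∁p⊆∁q⇒p⊇q (⊆-trans T⊆U U⊆))))

      isBetaPacking⇒isEdgeComplement : ∀ {S} → IsBetaPacking G β S → IsEdgeComplement G S
      isBetaPacking⇒isEdgeComplement (S-proper , S-propI , S-maximal)
        with proper-PropI⇒⊆∁edge β<1 noIsolated S-proper S-propI
      ... | c , d , d∈N , S⊆ =
        c , d , d∈N , ⊆-antisym S⊆ (S-maximal _ (c , x∈p⇒x∉∁p (x∈pair c d)) (∁edge-PropI d∈N) S⊆)

eqℕ⇒≡ : ∀ i j → eqℕ i j ≡ true → i ≡ j
eqℕ⇒≡ zero    zero    _  = refl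
eqℕ⇒≡ (suc i) (suc j) eq = cong suc (eqℕ⇒≡ i j eq)

eqℕ-refl : ∀ i → eqℕ i i ≡ true
eqℕ-refl zero    = refl
eqℕ-refl (suc i) = eqℕ-refl i

pathAdj⇒ : ∀ i j → pathAdj i j ≡ true → suc i ≡ j ⊎ suc j ≡ i
pathAdj⇒ i j ij with eqℕ (suc i) j in eq
... | true  = inj₁ (eqℕ⇒≡ (suc i) j eq)
... | false = inj₂ (eqℕ⇒≡ (suc j) i ij)

pathAdj-suc : ∀ i → pathAdj i (suc i) ≡ true
pathAdj-suc i rewrite eqℕ-refl i = refl

pathAdj-pigeonhole : ∀ {v a b c} → pathAdj v a ≡ true → pathAdj v b ≡ true → pathAdj v c ≡ true →
                     a ≡ b ⊎ a ≡ c ⊎ b ≡ c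
pathAdj-pigeonhole {v} {a} {b} {c} va vb vc = go (pathAdj⇒ v a va) (pathAdj⇒ v b vb) (pathAdj⇒ v c vc)
  where
  go : suc v ≡ a ⊎ suc a ≡ v → suc v ≡ b ⊎ suc b ≡ v → suc v ≡ c ⊎ suc c ≡ v → a ≡ b ⊎ a ≡ c ⊎ b ≡ c
  go (inj₁ refl) (inj₁ refl) _           = inj₁ refl
  go (inj₂ refl) (inj₂ refl) _           = inj₁ refl
  go (inj₁ refl) (inj₂ refl) (inj₁ refl) = inj₂ (inj₁ refl)
  go (inj₂ refl) (inj₁ refl) (inj₂ refl) = inj₂ (inj₁ refl)
  go (inj₁ refl) (inj₂ refl) (inj₂ refl) = inj₂ (inj₂ refl)
  go (inj₂ refl) (inj₁ refl) (inj₁ refl) = inj₂ (inj₂ refl)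

P-noIsolatedVertices : ∀ m → NoIsolatedVertices (P (suc (suc m)))
P-noIsolatedVertices m Fin.zero    = Fin.suc Fin.zero , adj⇒∈N (P (suc (suc m))) {Fin.zero} refl
P-noIsolatedVertices m (Fin.suc v) = inject₁ v , ∈N-sym (P (suc (suc m))) v+1∈N[v]
  where
  v+1∈N[v] : Fin.suc v ∈ N (P (suc (suc m))) (inject₁ v)
  v+1∈N[v] = adj⇒∈N (P (suc (suc m))) {inject₁ v}
    (subst (λ i → pathAdj i (suc (toℕ v)) ≡ true) (≡.sym (toℕ-inject₁ v)) (pathAdj-suc (toℕ v)))

P-maxDegree≤2 : ∀ n → MaxDegree≤2 (P n)
P-maxDegree≤2 n v u u∈N = ∣p∣≤1 (N (P n) v - u) unique
  where
  adjacent : ∀ {x} → x ∈ N (P n) v - u → pathAdj (toℕ v) (toℕ x) ≡ true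
  adjacent x∈ = ∈N⇒adj (P n) (p─q⊆p (N (P n) v) ⁅ u ⁆ x∈)
  unique : ∀ {x y} → x ∈ N (P n) v - u → y ∈ N (P n) v - u → x ≡ y
  unique x∈ y∈ with pathAdj-pigeonhole (adjacent x∈) (adjacent y∈) (∈N⇒adj (P n) u∈N)
  ... | inj₁ x≡y        = toℕ-injective x≡y
  ... | inj₂ (inj₁ x≡u) = contradiction (toℕ-injective x≡u) (x∈p-y⇒x≢y x∈)
  ... | inj₂ (inj₂ y≡u) = contradiction (toℕ-injective y≡u) (x∈p-y⇒x≢y y∈)

proposition2p2 : (n : ℕ) → 2 ≤ n → (β : ℚ) → ½ ≤ℚ β → β <ℚ 1ℚ →
    BetaPackNumberIs (P n) β (n ∸ 2) ×
    ((S : Subset n) → IsBetaPacking (P n) β S → InducedConnected (P n) (∁ S))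
proposition2p2 (suc (suc m)) _ β ½≤β β<1 =
    ((T₀ , isEdgeComplement⇒isBetaPacking T₀-isEdgeComplement , ∣T₀∣≡n∸2)
    , λ S → ℕP.≤-reflexive ∘ isEdgeComplement⇒∣S∣≡n∸2 G ∘ isBetaPacking⇒isEdgeComplement)
  , λ S → isEdgeComplement⇒∁-connected G ∘ isBetaPacking⇒isEdgeComplement
  where
  G : Graph (suc (suc m))
  G = P (suc (suc m))
  open EdgeComplements G β<1 (P-noIsolatedVertices m)
                       (maxDegree≤2⇒∁edge-PropI G ½≤β (P-maxDegree≤2 (suc (suc m))))
  T₀ : Subset (suc (suc m))
  T₀ = ∁ (pair Fin.zero (Fin.suc Fin.zero))
  T₀-isEdgeComplement : IsEdgeComplement G T₀
  T₀-isEdgeComplement = Fin.zero , Fin.suc Fin.zero , adj⇒∈N G {Fin.zero} refl , refl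
  ∣T₀∣≡n∸2 : ∣ T₀ ∣ ≡ suc (suc m) ∸ 2
  ∣T₀∣≡n∸2 = isEdgeComplement⇒∣S∣≡n∸2 G T₀-isEdgeComplement
proposition2p2 (suc zero) (s≤s ()) β ½≤β β<1
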